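{- If $n$, $a$ and $k$ are integers such that $n=k(a-1)$, $a\ge 4$ and $k\ge 3$, then $$\beta_b(\overrightarrow{C}(n;1,a)) = \beta_b(\overrightarrow{C}(n;1,-(n-a))) = (a-2)k.$$
   Context: For integers $n\ge 3$ and $b_1,\dots,b_k$, the oriented circulant graph $\overrightarrow{C}(n;b_1,\dots,b_k)$ has vertex set $\{v_0,\dots,v_{n-1}\}$ and arc set $\{v_iv_{i+b_j} : 0\le i\le n-1,\ 1\le j\le k\}$, with subscripts taken modulo $n$ (negative $b_j$ allowed). $d(u,v)$ is the length of a shortest directed path from $u$ to $v$; $e(v)=\max_u d(v,u)$ is the eccentricity; $\mathrm{diam}$ is the maximum eccentricity. An independent broadcast on an oriented graph $\overrightarrow{G}$ is a function $f:V(\overrightarrow{G})\to\{0,\dots,\mathrm{diam}(\overrightarrow{G})\}$ with $f(v)\le e(v)$ for all $v$, and $d(u,v)>f(u)$ for all distinct $u,v$ with $f(u),f(v)>0$. Its cost is $\sigma(f)=\sum_v f(v)$, and $\beta_b(\overrightarrow{G})$ is the maximum cost of an independent broadcast on $\overrightarrow{G}$. -}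

module Defs where

open import Data.Nat as ℕ using (ℕ; zero; suc; _≤_; _<_)
open import Data.Integer as ℤ using (ℤ; +_)
open import Data.Fin using (Fin; toℕ)
open import Data.List as List using (List; length)
open import Data.List.Relation.Unary.All using (All)
open import Data.List.Membership.Propositional using (_∈_)
open import Data.Nat.ListAction using (sum)
open import Data.Product using (Σ; ∃; ∃-syntax; _×_; _,_)
open import Relation.Binary.PropositionalEquality using (_≡_; _≢_)

-- Oriented circulant graph C(n; bs): vertices v_0..v_{n-1} (as Fin n),
-- arcs v_i → v_{i+b} (mod n) for each b in the list bs (negative b allowed).

sumℤ : List ℤ → ℤ
sumℤ = List.foldr ℤ._+_ (+ 0)

Walk : (n : ℕ) → List ℤ → Fin n → Fin n → List ℤ → Set
Walk n bs u v ws =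
  All (_∈ bs) ws × ∃[ q ] ((+ toℕ u) ℤ.+ sumℤ ws ≡ (+ toℕ v) ℤ.+ q ℤ.* (+ n))

Reach : (n : ℕ) → List ℤ → Fin n → Fin n → ℕ → Set
Reach n bs u v m = ∃[ ws ] (Walk n bs u v ws × length ws ≤ m)

IsDist : (n : ℕ) → List ℤ → Fin n → Fin n → ℕ → Set
IsDist n bs u v d = Reach n bs u v d × (∀ m → Reach n bs u v m → d ≤ m)

IsEcc : (n : ℕ) → List ℤ → Fin n → ℕ → Set
IsEcc n bs v e =
  (∀ u d → IsDist n bs v u d → d ≤ e) × ∃[ u ] IsDist n bs v u e

IsDiam : (n : ℕ) → List ℤ → ℕ → Set
IsDiam n bs D =
  (∀ v e → IsEcc n bs v e → e ≤ D) × ∃[ v ] IsEcc n bs v D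

IsIndepBroadcast : (n : ℕ) → List ℤ → (Fin n → ℕ) → Set
IsIndepBroadcast n bs f =
  (∀ v D → IsDiam n bs D → f v ≤ D)
  × (∀ v e → IsEcc n bs v e → f v ≤ e)
  × (∀ u v → u ≢ v → 0 < f u → 0 < f v → ∀ d → IsDist n bs u v d → f u < d)

cost : (n : ℕ) → (Fin n → ℕ) → ℕ
cost n f = sum (List.tabulate f)

IsBroadcastIndepNumber : (n : ℕ) → List ℤ → ℕ → Set
IsBroadcastIndepNumber n bs β =
  (∃[ f ] (IsIndepBroadcast n bs f × cost n f ≡ β))
  × (∀ f → IsIndepBroadcast n bs f → cost n f ≤ β)

{-# OPTIONS --safe #-}

-- Both steps 1 and a are ≡ 1 modulo p = a - 1, and p divides n, so every walk from u to v
-- has length ≡ v - u (mod p).  Hence the k multiples of p are pairwise at distance ≥ p and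
-- every eccentricity is ≥ a - 2: broadcasting a - 2 from each multiple of p is independent
-- and costs (a - 2) k.  Conversely, if u broadcasts and the next broadcasting vertex along
-- the cycle is u + g, then f(u) < d(u, u + g) ≤ ⌊g / a⌋ + g mod a, which forces
-- (a - 1) f(u) ≤ (a - 2) g; summing over the broadcasting vertices gives
-- (a - 1) σ(f) ≤ (a - 2) n = (a - 1)(a - 2) k.  (A lone broadcasting vertex has g = n and
-- is bounded by its eccentricity instead.)  Finally -(n - a) ≡ a (mod n), so the second
-- graph has the same arcs as the first.

module Submission where

open import Defs
open import Data.Nat as ℕ using (ℕ; zero; suc; z≤n; s≤s; _≤_; _<_; _∸_; NonZero)
import Data.Nat.Properties as ℕ
open import Data.Integer as ℤ using (ℤ)
import Data.Integer.Properties as ℤ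
open import Data.Integer.Divisibility.Signed using (_∣_; divides)
open import Data.List using (List; []; _∷_; length)
open import Data.List.Relation.Unary.All using (All; []; _∷_)
open import Data.List.Membership.Propositional using (_∈_)
open import Data.Product using (∃-syntax; _×_; _,_; proj₁; proj₂)
open import Data.Sum using (inj₁; inj₂)
open import Relation.Nullary using (Dec; yes; no)
open import Relation.Binary.PropositionalEquality
  using (_≡_; _≢_; refl; sym; trans; cong; cong₂; subst; module ≡-Reasoning)

module IntegerCongruence where

  open import Data.Integer using (+_; _+_; _-_; _*_; -_; ∣_∣)
  open import Data.Integer.Properties
    using (neg-distribˡ-*; pos-+; pos-*; +-injective; i-j≡0⇒i≡j; ∣i∣≡0⇒i≡0)
  open import Data.Integer.Properties using (m-n≡m⊖n; ∣m⊝n∣≤m⊔n)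
  open import Data.Integer.Divisibility.Signed using (∣⇒∣ᵤ; ∣m∣n⇒∣m+n; ∣-trans)
  open import Data.Integer.Tactic.RingSolver using (solve-∀)
  open import Data.Nat.DivMod using (_/_; _%_; m≡m%n+[m/n]*n)
  open import Data.Nat.Divisibility using (>⇒∤) renaming (_∣_ to _ℕ∣_)
  open import Level using (0ℓ)
  open import Relation.Binary.Bundles using (Setoid)
  import Relation.Binary.Reasoning.Setoid as SetoidReasoning
  open import Relation.Nullary using (contradiction)

  infix 4 _≡_[mod_]

  -- A record rather than a definition unfolding to divisibility, so that x, y and m can be
  -- inferred from a congruence.
  record _≡_[mod_] (x y m : ℤ) : Set where
    constructor mod∣
    field ∣difference : m ∣ x - y

  module _ {m : ℤ} where

    ≡[mod]⇒∃ : ∀ {x y} → x ≡ y [mod m ] → ∃[ q ] (x ≡ y + q * m)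
    ≡[mod]⇒∃ {x} {y} (mod∣ (divides q eq)) = q , (begin
      x            ≡⟨ split x y ⟩
      y + (x - y)  ≡⟨ cong (_+_ y) eq ⟩
      y + q * m    ∎)
      where
      open ≡-Reasoning
      split : ∀ x y → x ≡ y + (x - y)
      split = solve-∀

    ∃⇒≡[mod] : ∀ {x y} → ∃[ q ] (x ≡ y + q * m) → x ≡ y [mod m ]
    ∃⇒≡[mod] {x} {y} (q , eq) = mod∣ (divides q (trans (cong (_- y) eq) (cancel y (q * m))))
      where
      cancel : ∀ y z → y + z - y ≡ z
      cancel = solve-∀

    ≡[mod]-refl : ∀ {x} → x ≡ x [mod m ]
    ≡[mod]-refl {x} = mod∣ (divides (+ 0) (cancel x m))
      where
      cancel : ∀ x m → x - x ≡ + 0 * m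
      cancel = solve-∀

    ≡[mod]-sym : ∀ {x y} → x ≡ y [mod m ] → y ≡ x [mod m ]
    ≡[mod]-sym {x} {y} (mod∣ (divides q eq)) = mod∣ (divides (- q) (begin
      y - x        ≡⟨ flip x y ⟩
      - (x - y)    ≡⟨ cong -_ eq ⟩
      - (q * m)    ≡⟨ neg-distribˡ-* q m ⟩
      - q * m      ∎))
      where
      open ≡-Reasoning
      flip : ∀ x y → y - x ≡ - (x - y)
      flip = solve-∀

    ≡[mod]-+ : ∀ {x y x′ y′} → x ≡ y [mod m ] → x′ ≡ y′ [mod m ] → x + x′ ≡ y + y′ [mod m ]
    ≡[mod]-+ {x} {y} {x′} {y′} (mod∣ d) (mod∣ d′) =
      mod∣ (subst (m ∣_) (regroup x y x′ y′) (∣m∣n⇒∣m+n d d′))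
      where
      regroup : ∀ x y x′ y′ → (x - y) + (x′ - y′) ≡ (x + x′) - (y + y′)
      regroup = solve-∀

    ≡[mod]-+ˡ : ∀ x {y z} → y ≡ z [mod m ] → x + y ≡ x + z [mod m ]
    ≡[mod]-+ˡ x = ≡[mod]-+ (≡[mod]-refl {x = x})

    ≡[mod]-+ʳ : ∀ {x y} z → x ≡ y [mod m ] → x + z ≡ y + z [mod m ]
    ≡[mod]-+ʳ z x≡y = ≡[mod]-+ x≡y (≡[mod]-refl {x = z})

    ≡[mod]-trans : ∀ {x y z} → x ≡ y [mod m ] → y ≡ z [mod m ] → x ≡ z [mod m ]
    ≡[mod]-trans {x} {y} {z} (mod∣ d) (mod∣ d′) =
      mod∣ (subst (m ∣_) (telescope x y z) (∣m∣n⇒∣m+n d d′))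
      where
      telescope : ∀ x y z → (x - y) + (y - z) ≡ x - z
      telescope = solve-∀

    ≡[mod]-cancelˡ-+ : ∀ {x y z} → x + y ≡ x + z [mod m ] → y ≡ z [mod m ]
    ≡[mod]-cancelˡ-+ {x} {y} {z} (mod∣ d) = mod∣ (subst (m ∣_) (cancel x y z) d)
      where
      cancel : ∀ x y z → (x + y) - (x + z) ≡ y - z
      cancel = solve-∀

  modulus≡0 : ∀ m → m ≡ + 0 [mod m ]
  modulus≡0 m = mod∣ (divides (+ 1) (identity m))
    where
    identity : ∀ m → m - + 0 ≡ + 1 * m
    identity = solve-∀

  ≡[mod]-setoid : ℤ → Setoid 0ℓ 0ℓ
  ≡[mod]-setoid m = record
    { Carrier       = ℤ
    ; _≈_           = _≡_[mod m ]
    ; isEquivalence = record { refl = ≡[mod]-refl ; sym = ≡[mod]-sym ; trans = ≡[mod]-trans }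
    }

  module ≡[mod]-Reasoning (m : ℤ) = SetoidReasoning (≡[mod]-setoid m)

  %-≡[mod] : ∀ x d .{{_ : NonZero d}} → + (x % d) ≡ + x [mod + d ]
  %-≡[mod] x d = ≡[mod]-sym (∃⇒≡[mod] (+ (x / d) , (begin
    + x                          ≡⟨ cong +_ (m≡m%n+[m/n]*n x d) ⟩
    + (x % d ℕ.+ x / d ℕ.* d)     ≡⟨ pos-+ (x % d) (x / d ℕ.* d) ⟩
    + (x % d) + + (x / d ℕ.* d)   ≡⟨ cong (_+_ (+ (x % d))) (pos-* (x / d) d) ⟩
    + (x % d) + + (x / d) * + d   ∎)))
    where open ≡-Reasoning

  ≡0[mod]⇒∣ : ∀ {d x} → + x ≡ + 0 [mod + d ] → d ℕ∣ x
  ≡0[mod]⇒∣ {d} {x} (mod∣ d∣x) = subst (d ℕ∣_) (ℕ.+-identityʳ x) (∣⇒∣ᵤ d∣x)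

  ≡[mod]⇒≡ : ∀ {n x y} → x < n → y < n → + x ≡ + y [mod + n ] → x ≡ y
  ≡[mod]⇒≡ {n} {x} {y} x<n y<n (mod∣ n∣x-y) =
    +-injective (i-j≡0⇒i≡j (+ x) (+ y)
      (∣i∣≡0⇒i≡0 (divisible-below⇒≡0 (∣⇒∣ᵤ n∣x-y) ∣x-y∣<n)))
    where
    ∣x-y∣<n : ∣ + x - + y ∣ < n
    ∣x-y∣<n = subst (_< n) (cong ∣_∣ (sym (m-n≡m⊖n x y)))
                (ℕ.≤-<-trans (∣m⊝n∣≤m⊔n x y) (ℕ.⊔-lub x<n y<n))
    divisible-below⇒≡0 : ∀ {m} → n ℕ∣ m → m < n → m ≡ 0
    divisible-below⇒≡0 {zero}  _   _   = refl
    divisible-below⇒≡0 {suc _} n∣m m<n = contradiction n∣m (>⇒∤ m<n)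

  ≡[mod]-weaken : ∀ {d m x y} → d ∣ m → x ≡ y [mod m ] → x ≡ y [mod d ]
  ≡[mod]-weaken d∣m (mod∣ m∣x-y) = mod∣ (∣-trans d∣m m∣x-y)

open IntegerCongruence

module InitialSegmentSums where

  open import Data.Nat using (_+_; _*_)
  open import Data.Nat.ListAction using (sum)
  open import Data.Nat.ListAction.Properties using (sum-++)
  open import Data.List using (_++_; _∷ʳ_; applyUpTo; tabulate)
  open import Data.List.Properties using (applyUpTo-∷ʳ)
  open import Data.Fin as Fin using (Fin; toℕ)
  open import Function using (_∘_)

  ∑ : ℕ → (ℕ → ℕ) → ℕ
  ∑ L h = sum (applyUpTo h L)

  ∑-suc : ∀ L h → ∑ (suc L) h ≡ ∑ L h + h L
  ∑-suc L h = begin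
    sum (applyUpTo h (suc L))       ≡⟨ cong sum (applyUpTo-∷ʳ h L) ⟨
    sum (applyUpTo h L ∷ʳ h L)      ≡⟨ sum-++ (applyUpTo h L) _ ⟩
    ∑ L h + (h L + 0)               ≡⟨ cong (∑ L h +_) (ℕ.+-identityʳ (h L)) ⟩
    ∑ L h + h L                     ∎
    where open ≡-Reasoning

  applyUpTo-+ : ∀ {A : Set} (h : ℕ → A) L M →
                applyUpTo h (L + M) ≡ applyUpTo h L ++ applyUpTo (h ∘ (L +_)) M
  applyUpTo-+ h zero    M = refl
  applyUpTo-+ h (suc L) M = cong (h 0 ∷_) (applyUpTo-+ (h ∘ suc) L M)

  ∑-+ : ∀ L M h → ∑ (L + M) h ≡ ∑ L h + ∑ M (h ∘ (L +_))
  ∑-+ L M h = trans (cong sum (applyUpTo-+ h L M)) (sum-++ (applyUpTo h L) _)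

  ∑-cong : ∀ L {g h} → (∀ {t} → t < L → g t ≡ h t) → ∑ L g ≡ ∑ L h
  ∑-cong zero    g≡h = refl
  ∑-cong (suc L) g≡h = cong₂ _+_ (g≡h ℕ.z<s) (∑-cong L (g≡h ∘ ℕ.s<s))

  ∑-zero : ∀ L {h} → (∀ {t} → t < L → h t ≡ 0) → ∑ L h ≡ 0
  ∑-zero zero    h≡0 = refl
  ∑-zero (suc L) h≡0 = cong₂ _+_ (h≡0 ℕ.z<s) (∑-zero L (h≡0 ∘ ℕ.s<s))

  ∑-periodic-shift : ∀ n {h} → (∀ x → h (n + x) ≡ h x) → ∀ r → ∑ n (h ∘ (r +_)) ≡ ∑ n h
  ∑-periodic-shift n {h} periodic r = ℕ.+-cancelˡ-≡ (∑ r h) _ _ (begin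
    ∑ r h + ∑ n (h ∘ (r +_))   ≡⟨ ∑-+ r n h ⟨
    ∑ (r + n) h                ≡⟨ cong (λ L → ∑ L h) (ℕ.+-comm r n) ⟩
    ∑ (n + r) h                ≡⟨ ∑-+ n r h ⟩
    ∑ n h + ∑ r (h ∘ (n +_))   ≡⟨ cong (∑ n h +_) (∑-cong r (λ {t} _ → periodic t)) ⟩
    ∑ n h + ∑ r h              ≡⟨ ℕ.+-comm (∑ n h) (∑ r h) ⟩
    ∑ r h + ∑ n h              ∎)
    where open ≡-Reasoning

  sum-tabulate : ∀ n {g : Fin n → ℕ} {h} → (∀ i → g i ≡ h (toℕ i)) → sum (tabulate g) ≡ ∑ n h
  sum-tabulate zero    g≡h = refl
  sum-tabulate (suc n) g≡h = cong₂ _+_ (g≡h Fin.zero) (sum-tabulate n (g≡h ∘ Fin.suc))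

  -- Each positive value h p is paid for by the gap up to the next positive value; the
  -- positive value at q pays nothing itself and only closes the last gap.
  module _ {c d Q : ℕ} (h : ℕ → ℕ)
    (gap : ∀ {p q} → p < q → q ≤ Q → 0 < h p → 0 < h q → c * h p ≤ d * (q ∸ p)) where

    ∑-gap-bound : ∀ L {q} → L ≤ q → q ≤ Q → 0 < h q → c * ∑ L h ≤ d * q
    ∑-gap-bound zero    _   _   _  = ℕ.≤-trans (ℕ.≤-reflexive (ℕ.*-zeroʳ c)) z≤n
    ∑-gap-bound (suc L) {q} L<q q≤Q hq with 0 ℕ.<? h L
    ... | yes hL = begin
      c * ∑ (suc L) h          ≡⟨ c*∑-suc ⟩
      c * ∑ L h + c * h L      ≤⟨ ℕ.+-mono-≤ (∑-gap-bound L ℕ.≤-refl L≤Q hL) (gap L<q q≤Q hL hq) ⟩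
      d * L + d * (q ∸ L)      ≡⟨ ℕ.*-distribˡ-+ d L (q ∸ L) ⟨
      d * (L + (q ∸ L))        ≡⟨ cong (d *_) (ℕ.m+[n∸m]≡n (ℕ.<⇒≤ L<q)) ⟩
      d * q                    ∎
      where
      open ℕ.≤-Reasoning
      L≤Q : L ≤ Q
      L≤Q = ℕ.≤-trans (ℕ.<⇒≤ L<q) q≤Q
      c*∑-suc : c * ∑ (suc L) h ≡ c * ∑ L h + c * h L
      c*∑-suc = trans (cong (c *_) (∑-suc L h)) (ℕ.*-distribˡ-+ c (∑ L h) (h L))
    ... | no ¬hL = begin
      c * ∑ (suc L) h          ≡⟨ cong (c *_) (∑-suc L h) ⟩
      c * (∑ L h + h L)        ≡⟨ cong (λ y → c * (∑ L h + y)) (ℕ.n≤0⇒n≡0 (ℕ.≮⇒≥ ¬hL)) ⟩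
      c * (∑ L h + 0)          ≡⟨ cong (c *_) (ℕ.+-identityʳ (∑ L h)) ⟩
      c * ∑ L h                ≤⟨ ∑-gap-bound L (ℕ.<⇒≤ L<q) q≤Q hq ⟩
      d * q                    ∎
      where open ℕ.≤-Reasoning

open InitialSegmentSums

module CirculantGraphs where

  open import Data.Integer using (+_; _+_)
  open import Data.Integer.Divisibility.Signed using (_∣?_)
  open import Data.Fin using (Fin; toℕ)
  open import Data.Fin.Properties using (toℕ-injective; toℕ<n)
  open import Data.List using (allFin)
  open import Data.List.Relation.Unary.All as All using ()
  open import Data.List.Relation.Unary.Any using (Any; any?)
  open import Data.List.Membership.Propositional using (find; lose)
  open import Data.List.Membership.Propositional.Properties using (∈-allFin)
  open import Data.List.Extrema.Nat using (argmax; f[xs]≤f[argmax])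
  open import Data.Product using (swap)
  open import Data.Sum using (_⊎_)
  open import Function using (_∘_)
  open import Relation.Nullary.Decidable using (map′; _⊎-dec_)
  open import Relation.Unary using (Decidable)

  reach-mono : ∀ {n bs u v l m} → Reach n bs u v l → l ≤ m → Reach n bs u v m
  reach-mono (ws , walk , length≤l) l≤m = ws , walk , ℕ.≤-trans length≤l l≤m

  module _ {A : Set} (bs : List A) where

    BoundedWitness : (List A → Set) → ℕ → Set
    BoundedWitness P m = ∃[ ws ] ((All (_∈ bs) ws × P ws) × length ws ≤ m)

    boundedWitness? : ∀ {P} → Decidable P → ∀ m → Dec (BoundedWitness P m)
    boundedWitness? P? zero =
      map′ (λ p → [] , ([] , p) , z≤n) (λ { ([] , (_ , p) , _) → p }) (P? [])
    boundedWitness? {P} P? (suc m) =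
      map′ from to (P? [] ⊎-dec any? (λ b → boundedWitness? (P? ∘ (b ∷_)) m) bs)
      where
      Extension : Set
      Extension = Any (λ b → BoundedWitness (P ∘ (b ∷_)) m) bs
      from : P [] ⊎ Extension → BoundedWitness P (suc m)
      from (inj₁ p) = [] , ([] , p) , z≤n
      from (inj₂ ext) with find ext
      ... | b , b∈bs , ws , (all , p) , length≤m = b ∷ ws , (b∈bs ∷ all , p) , s≤s length≤m
      to : BoundedWitness P (suc m) → P [] ⊎ Extension
      to ([] , (_ , p) , _) = inj₁ p
      to (b ∷ ws , (b∈bs ∷ all , p) , s≤s length≤m) =
        inj₂ (lose b∈bs (ws , (all , p) , length≤m))

  reach? : ∀ n bs (u v : Fin n) m → Dec (Reach n bs u v m)
  reach? n bs u v = boundedWitness? bs closes?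
    where
    closes? : ∀ ws → Dec (∃[ q ] (+ toℕ u + sumℤ ws ≡ + toℕ v + q ℤ.* + n))
    closes? ws = map′ (≡[mod]⇒∃ ∘ mod∣) (_≡_[mod_].∣difference ∘ ∃⇒≡[mod])
                      (+ n ∣? (+ toℕ u + sumℤ ws ℤ.- + toℕ v))

  module _ {P : ℕ → Set} (P? : Decidable P) (P-mono : ∀ {l m} → P l → l ≤ m → P m) where

    least : ∀ {L} → P L → ∃[ d ] ((P d × (∀ m → P m → d ≤ m)) × d ≤ L)
    least {zero}  p = 0 , (p , λ _ _ → z≤n) , z≤n
    least {suc L} p with P? L
    ... | yes q = let d , isLeast , d≤L = least q in d , isLeast , ℕ.m≤n⇒m≤1+n d≤L
    ... | no ¬q = suc L , (p , λ m pm → ℕ.≰⇒> (¬q ∘ P-mono pm)) , ℕ.≤-refl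

  walk-[]⇒≡ : ∀ {n bs u v} → Walk n bs u v [] → u ≡ v
  walk-[]⇒≡ {n} {u = u} {v} (_ , closes) =
    toℕ-injective (≡[mod]⇒≡ (toℕ<n u) (toℕ<n v) (begin
    + toℕ u            ≡⟨ ℤ.+-identityʳ (+ toℕ u) ⟨
    + toℕ u + + 0      ≈⟨ ∃⇒≡[mod] closes ⟩
    + toℕ v            ∎))
    where open ≡[mod]-Reasoning (+ n)

  dist-exists : ∀ {n bs u v L} → Reach n bs u v L → ∃[ d ] (IsDist n bs u v d × d ≤ L)
  dist-exists {n} {bs} {u} {v} = least (reach? n bs u v) reach-mono

  ecc-exists : ∀ {n bs L} (v : Fin n) → (∀ w → Reach n bs v w L) → ∃[ e ] (IsEcc n bs v e × e ≤ L)
  ecc-exists {n} {bs} {L} v reach =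
    δ w* , (δ-max , w* , isDist w*) , proj₂ (proj₂ (dist-exists (reach w*)))
    where
    δ : Fin n → ℕ
    δ w = proj₁ (dist-exists (reach w))
    isDist : ∀ w → IsDist n bs v w (δ w)
    isDist w = proj₁ (proj₂ (dist-exists (reach w)))
    w* : Fin n
    w* = argmax δ v (allFin n)
    δ-max : ∀ u d → IsDist n bs v u d → d ≤ δ w*
    δ-max u d (_ , d-least) = ℕ.≤-trans (d-least (δ u) (proj₁ (isDist u)))
      (All.lookup (f[xs]≤f[argmax] {f = δ} v (allFin n)) (∈-allFin u))

  SameReach : ℕ → List ℤ → List ℤ → Set
  SameReach n bs bs′ =
    ∀ {u v m} → (Reach n bs u v m → Reach n bs′ u v m) × (Reach n bs′ u v m → Reach n bs u v m)

  SameReach-sym : ∀ {n bs bs′} → SameReach n bs bs′ → SameReach n bs′ bs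
  SameReach-sym same = swap same

  module _ {n : ℕ} where

    isDist-transport : ∀ {bs bs′ u v d} → SameReach n bs bs′ → IsDist n bs u v d → IsDist n bs′ u v d
    isDist-transport same (reach , shortest) = proj₁ same reach , λ m reach′ → shortest m (proj₂ same reach′)

    isEcc-transport : ∀ {bs bs′ v e} → SameReach n bs bs′ → IsEcc n bs v e → IsEcc n bs′ v e
    isEcc-transport same (max , u , dist) =
      (λ w d dist′ → max w d (isDist-transport (SameReach-sym same) dist′)) ,
      u , isDist-transport same dist

    isDiam-transport : ∀ {bs bs′ D} → SameReach n bs bs′ → IsDiam n bs D → IsDiam n bs′ D
    isDiam-transport same (max , v , ecc) =
      (λ w e ecc′ → max w e (isEcc-transport (SameReach-sym same) ecc′)) ,
      v , isEcc-transport same ecc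

    isIndepBroadcast-transport : ∀ {bs bs′ f} → SameReach n bs bs′ →
      IsIndepBroadcast n bs f → IsIndepBroadcast n bs′ f
    isIndepBroadcast-transport same (≤diam , ≤ecc , independent) =
      (λ v D diam → ≤diam v D (isDiam-transport (SameReach-sym same) diam)) ,
      (λ v e ecc → ≤ecc v e (isEcc-transport (SameReach-sym same) ecc)) ,
      (λ u v u≢v fu fv d dist →
        independent u v u≢v fu fv d (isDist-transport (SameReach-sym same) dist))

    isBroadcastIndepNumber-transport : ∀ {bs bs′ β} → SameReach n bs bs′ →
      IsBroadcastIndepNumber n bs β → IsBroadcastIndepNumber n bs′ β
    isBroadcastIndepNumber-transport same ((f , indep , cost≡β) , max) =
      (f , isIndepBroadcast-transport same indep , cost≡β) ,
      λ g indep′ → max g (isIndepBroadcast-transport (SameReach-sym same) indep′)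

  module _ {n : ℕ} {bs bs′ : List ℤ}
    (congruent : ∀ {b} → b ∈ bs → ∃[ c ] (c ∈ bs′ × (b ≡ c [mod + n ]))) where

    translate : ∀ {ws} → All (_∈ bs) ws →
      ∃[ ws′ ] (All (_∈ bs′) ws′ × length ws′ ≡ length ws × (sumℤ ws ≡ sumℤ ws′ [mod + n ]))
    translate [] = [] , [] , refl , ≡[mod]-refl
    translate (b∈bs ∷ all) with congruent b∈bs | translate all
    ... | c , c∈bs′ , b≡c | ws′ , all′ , same-length , sum≡ =
      c ∷ ws′ , c∈bs′ ∷ all′ , cong suc same-length , ≡[mod]-+ b≡c sum≡

    reach-translate : ∀ {u v m} → Reach n bs u v m → Reach n bs′ u v m
    reach-translate {u} {v} (ws , (all , closes) , length≤m) with translate all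
    ... | ws′ , all′ , same-length , sum≡ =
      ws′ , (all′ , ≡[mod]⇒∃ closes′) , subst (_≤ _) (sym same-length) length≤m
      where
      closes′ : + toℕ u + sumℤ ws′ ≡ + toℕ v [mod + n ]
      closes′ = ≡[mod]-trans (≡[mod]-+ˡ (+ toℕ u) (≡[mod]-sym sum≡)) (∃⇒≡[mod] closes)

open CirculantGraphs

module _ where

  open import Data.Nat using (_+_; _*_)
  open import Data.Nat.Tactic.RingSolver using (solve-∀)

  jump-count-bound : ∀ ℓ .{{_ : NonZero ℓ}} q {r} → r ≤ suc ℓ →
                     suc ℓ * (r + q) ≤ ℓ * (r + q * suc (suc ℓ)) + suc ℓ
  jump-count-bound (suc l) q {r} r≤p with ℕ.m≤n⇒∃[o]m+o≡n r≤p
  ... | s , r+s≡p = begin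
    suc (suc l) * (r + q)                                   ≤⟨ ℕ.m≤m+n _ _ ⟩
    suc (suc l) * (r + q) + (q * (l * l + 3 * l + 1) + s)  ≡⟨ expand l q r s ⟩
    suc l * (r + q * suc (suc (suc l))) + (r + s)
      ≡⟨ cong (suc l * (r + q * suc (suc (suc l))) +_) r+s≡p ⟩
    suc l * (r + q * suc (suc (suc l))) + suc (suc l)       ∎
    where
    open ℕ.≤-Reasoning
    expand : ∀ l q r s → suc (suc l) * (r + q) + (q * (l * l + 3 * l + 1) + s)
                       ≡ suc l * (r + q * suc (suc (suc l))) + (r + s)
    expand = solve-∀

module Circulant-1-a (ℓ k : ℕ) .{{_ : NonZero ℓ}} .{{_ : NonZero k}} where

  open import Data.Nat using (_+_; _*_)
  open import Data.Nat.DivMod using (_/_; _%_; _mod_; m%n<n; m<n⇒m%n≡m; m≡m%n+[m/n]*n; %-remove-+ˡ)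
  open import Data.Nat.Divisibility using (∣-refl; ∣⇒≤)
  open import Data.Nat.Tactic.RingSolver as ℕ-Solver using ()
  open import Data.Integer using (+_)
  open import Data.Integer.Properties using (pos-+; pos-*)
  open import Data.Integer.Tactic.RingSolver as ℤ-Solver using ()
  open import Data.Fin using (Fin; toℕ)
  open import Data.Fin.Properties using (toℕ-fromℕ<; toℕ-injective; toℕ<n; any?)
  open import Data.List.Relation.Unary.Any using (here; there)
  open import Function using (_∘_)
  open import Relation.Nullary using (contradiction)

  p a n : ℕ
  p = suc ℓ
  a = suc p
  n = k * p

  instance
    n≢0 : NonZero n
    n≢0 = ℕ.m*n≢0 k p

  gens : List ℤ
  gens = + 1 ∷ + a ∷ []

  p∣n : + p ∣ + n
  p∣n = divides (+ k) (pos-* k p)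

  ℓ*n≡p*[ℓ*k] : ℓ * n ≡ p * (ℓ * k)
  ℓ*n≡p*[ℓ*k] = regroup ℓ k p
    where
    regroup : ∀ ℓ k p → ℓ * (k * p) ≡ p * (ℓ * k)
    regroup = ℕ-Solver.solve-∀

  vertex : ℕ → Fin n
  vertex x = x mod n

  toℕ-vertex : ∀ x → toℕ (vertex x) ≡ x % n
  toℕ-vertex x = toℕ-fromℕ< (m%n<n x n)

  vertex-toℕ : ∀ v → vertex (toℕ v) ≡ v
  vertex-toℕ v = toℕ-injective (trans (toℕ-vertex (toℕ v)) (m<n⇒m%n≡m (toℕ<n v)))

  vertex-periodic : ∀ x → vertex (n + x) ≡ vertex x
  vertex-periodic x = toℕ-injective (trans (toℕ-vertex (n + x))
    (trans (%-remove-+ˡ x (∣-refl {n})) (sym (toℕ-vertex x))))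

  vertex≡[mod] : ∀ x → + toℕ (vertex x) ≡ + x [mod + n ]
  vertex≡[mod] x = subst (λ y → + y ≡ + x [mod + n ]) (sym (toℕ-vertex x)) (%-≡[mod] x n)

  vertex-+ : ∀ x t → + toℕ (vertex x) ℤ.+ + t ≡ + toℕ (vertex (x + t)) [mod + n ]
  vertex-+ x t = begin
    + toℕ (vertex x) ℤ.+ + t   ≈⟨ ≡[mod]-+ʳ (+ t) (vertex≡[mod] x) ⟩
    + x ℤ.+ + t                ≡⟨ pos-+ x t ⟨
    + (x + t)                  ≈⟨ vertex≡[mod] (x + t) ⟨
    + toℕ (vertex (x + t))     ∎
    where open ≡[mod]-Reasoning (+ n)

  vertex-+-≢ : ∀ x {g} → 0 < g → g < n → vertex x ≢ vertex (x + g)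
  vertex-+-≢ x {g} g>0 g<n vx≡vx+g =
    ℕ.<⇒≢ g>0 (≡[mod]⇒≡ (ℕ.>-nonZero⁻¹ n) g<n (≡[mod]-cancelˡ-+ {x = + toℕ (vertex x)} (begin
      + toℕ (vertex x) ℤ.+ + 0   ≡⟨ ℤ.+-identityʳ (+ toℕ (vertex x)) ⟩
      + toℕ (vertex x)           ≡⟨ cong (+_ ∘ toℕ) vx≡vx+g ⟩
      + toℕ (vertex (x + g))     ≈⟨ vertex-+ x g ⟨
      + toℕ (vertex x) ℤ.+ + g   ∎)))
    where open ≡[mod]-Reasoning (+ n)

  steps : ℕ → ℕ → List ℤ
  steps q       (suc r) = + 1 ∷ steps q r
  steps (suc q) zero    = + a ∷ steps q zero
  steps zero    zero    = []

  steps-gens : ∀ q r → All (_∈ gens) (steps q r)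
  steps-gens q       (suc r) = here refl ∷ steps-gens q r
  steps-gens (suc q) zero    = there (here refl) ∷ steps-gens q zero
  steps-gens zero    zero    = []

  length-steps : ∀ q r → length (steps q r) ≡ r + q
  length-steps q       (suc r) = cong suc (length-steps q r)
  length-steps (suc q) zero    = cong suc (length-steps q zero)
  length-steps zero    zero    = refl

  sum-steps : ∀ q r → sumℤ (steps q r) ≡ + (r + q * a)
  sum-steps q       (suc r) = cong (ℤ._+_ (+ 1)) (sum-steps q r)
  sum-steps (suc q) zero    = cong (ℤ._+_ (+ a)) (sum-steps q zero)
  sum-steps zero    zero    = refl

  hops : ℕ → ℕ
  hops t = t % a + t / a

  reach-forward : ∀ {u v} t → + toℕ u ℤ.+ + t ≡ + toℕ v [mod + n ] → Reach n gens u v (hops t)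
  reach-forward {u} {v} t u+t≡v =
    steps (t / a) (t % a) ,
    (steps-gens (t / a) (t % a) ,
     ≡[mod]⇒∃ (subst (λ s → + toℕ u ℤ.+ s ≡ + toℕ v [mod + n ]) (sym sum≡t) u+t≡v)) ,
    ℕ.≤-reflexive (length-steps (t / a) (t % a))
    where
    sum≡t : sumℤ (steps (t / a) (t % a)) ≡ + t
    sum≡t = trans (sum-steps (t / a) (t % a)) (cong +_ (sym (m≡m%n+[m/n]*n t a)))

  p*hops[t]≤ℓ*t+p : ∀ t → p * hops t ≤ ℓ * t + p
  p*hops[t]≤ℓ*t+p t = subst (λ t′ → p * hops t ≤ ℓ * t′ + p) (sym (m≡m%n+[m/n]*n t a))
                        (jump-count-bound ℓ (t / a) (ℕ.≤-pred (m%n<n t a)))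

  hops≤ℓ*k : ∀ {t} → t < n → hops t ≤ ℓ * k
  hops≤ℓ*k {t} t<n = ℕ.≤-pred (ℕ.*-cancelˡ-< p (hops t) (suc (ℓ * k)) (begin-strict
    p * hops t        ≤⟨ p*hops[t]≤ℓ*t+p t ⟩
    ℓ * t + p         <⟨ ℕ.+-monoˡ-< p (ℕ.*-monoʳ-< ℓ t<n) ⟩
    ℓ * n + p         ≡⟨ cong (_+ p) ℓ*n≡p*[ℓ*k] ⟩
    p * (ℓ * k) + p   ≡⟨ ℕ.+-comm (p * (ℓ * k)) p ⟩
    p + p * (ℓ * k)   ≡⟨ ℕ.*-suc p (ℓ * k) ⟨
    p * suc (ℓ * k)   ∎))
    where open ℕ.≤-Reasoning

  reach-within-ℓ*k : ∀ v w → Reach n gens v w (ℓ * k)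
  reach-within-ℓ*k v w = reach-mono (reach-forward (s % n) v+s%n≡w) (hops≤ℓ*k (m%n<n s n))
    where
    s : ℕ
    s = n ∸ toℕ v + toℕ w
    v+s≡n+w : toℕ v + s ≡ n + toℕ w
    v+s≡n+w = trans (sym (ℕ.+-assoc (toℕ v) (n ∸ toℕ v) (toℕ w)))
                    (cong (_+ toℕ w) (ℕ.m+[n∸m]≡n (ℕ.<⇒≤ (toℕ<n v))))
    v+s%n≡w : + toℕ v ℤ.+ + (s % n) ≡ + toℕ w [mod + n ]
    v+s%n≡w = begin
      + toℕ v ℤ.+ + (s % n)   ≈⟨ ≡[mod]-+ˡ (+ toℕ v) (%-≡[mod] s n) ⟩
      + toℕ v ℤ.+ + s         ≡⟨ pos-+ (toℕ v) s ⟨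
      + (toℕ v + s)           ≡⟨ cong +_ v+s≡n+w ⟩
      + (n + toℕ w)           ≡⟨ pos-+ n (toℕ w) ⟩
      + n ℤ.+ + toℕ w         ≈⟨ ≡[mod]-+ʳ (+ toℕ w) (modulus≡0 (+ n)) ⟩
      + toℕ w                 ∎
      where open ≡[mod]-Reasoning (+ n)

  sum≡length : ∀ {ws} → All (_∈ gens) ws → sumℤ ws ≡ + length ws [mod + p ]
  sum≡length []                       = ≡[mod]-refl
  sum≡length (here refl ∷ ws)         = ≡[mod]-+ˡ (+ 1) (sum≡length ws)
  sum≡length (there (here refl) ∷ ws) =
    ≡[mod]-+ (≡[mod]-+ˡ (+ 1) (modulus≡0 (+ p))) (sum≡length ws)

  start+length≡end : ∀ {u v ws} → Walk n gens u v ws → + toℕ u ℤ.+ + length ws ≡ + toℕ v [mod + p ]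
  start+length≡end {u} {v} {ws} (all , closes) = begin
    + toℕ u ℤ.+ + length ws   ≈⟨ ≡[mod]-+ˡ (+ toℕ u) (sum≡length all) ⟨
    + toℕ u ℤ.+ sumℤ ws       ≈⟨ ≡[mod]-weaken p∣n (∃⇒≡[mod] closes) ⟩
    + toℕ v                   ∎
    where open ≡[mod]-Reasoning (+ p)

  %≡0⇒≡0[mod] : ∀ {x} → x % p ≡ 0 → + x ≡ + 0 [mod + p ]
  %≡0⇒≡0[mod] {x} x%p≡0 = ≡[mod]-sym (subst (λ r → + r ≡ + x [mod + p ]) x%p≡0 (%-≡[mod] x p))

  p≤length-between-multiples : ∀ {u v ws} → u ≢ v → toℕ u % p ≡ 0 → toℕ v % p ≡ 0 →
                               Walk n gens u v ws → p ≤ length ws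
  p≤length-between-multiples {ws = []} u≢v _ _ walk = contradiction (walk-[]⇒≡ walk) u≢v
  p≤length-between-multiples {u} {v} {w ∷ ws} _ u%p≡0 v%p≡0 walk = ∣⇒≤ (≡0[mod]⇒∣ (begin
    + 0 ℤ.+ + length (w ∷ ws)       ≈⟨ ≡[mod]-+ʳ (+ length (w ∷ ws)) (%≡0⇒≡0[mod] u%p≡0) ⟨
    + toℕ u ℤ.+ + length (w ∷ ws)   ≈⟨ start+length≡end walk ⟩
    + toℕ v                         ≈⟨ %≡0⇒≡0[mod] v%p≡0 ⟩
    + 0                             ∎))
    where open ≡[mod]-Reasoning (+ p)

  ℓ≤length-ℓ-ahead : ∀ {u ws} → Walk n gens u (vertex (toℕ u + ℓ)) ws → ℓ ≤ length ws
  ℓ≤length-ℓ-ahead {u} {ws} walk = ℕ.≤-pred (∣⇒≤ (≡0[mod]⇒∣ (begin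
    + 1 ℤ.+ + length ws    ≈⟨ ≡[mod]-+ˡ (+ 1) length≡ℓ ⟩
    + p                    ≈⟨ modulus≡0 (+ p) ⟩
    + 0                    ∎)))
    where
    open ≡[mod]-Reasoning (+ p)
    length≡ℓ : + length ws ≡ + ℓ [mod + p ]
    length≡ℓ = ≡[mod]-cancelˡ-+ {x = + toℕ u} (begin
      + toℕ u ℤ.+ + length ws      ≈⟨ start+length≡end walk ⟩
      + toℕ (vertex (toℕ u + ℓ))   ≈⟨ ≡[mod]-weaken p∣n (vertex≡[mod] (toℕ u + ℓ)) ⟩
      + (toℕ u + ℓ)                ≡⟨ pos-+ (toℕ u) ℓ ⟩
      + toℕ u ℤ.+ + ℓ              ∎)

  ℓ≤ecc : ∀ {v e} → IsEcc n gens v e → ℓ ≤ e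
  ℓ≤ecc {v} (ecc-max , _) =
    let d , dist , _ = dist-exists (reach-forward ℓ v+ℓ≡w) in
    ℕ.≤-trans (ℓ≤dist dist) (ecc-max w d dist)
    where
    w : Fin n
    w = vertex (toℕ v + ℓ)
    v+ℓ≡w : + toℕ v ℤ.+ + ℓ ≡ + toℕ w [mod + n ]
    v+ℓ≡w = subst (λ u → + toℕ u ℤ.+ + ℓ ≡ + toℕ w [mod + n ]) (vertex-toℕ v) (vertex-+ (toℕ v) ℓ)
    ℓ≤dist : ∀ {d} → IsDist n gens v w d → ℓ ≤ d
    ℓ≤dist ((ws , walk , ws≤d) , _) = ℕ.≤-trans (ℓ≤length-ℓ-ahead walk) ws≤d

  ℓ-at-zero : ℕ → ℕ
  ℓ-at-zero zero    = ℓ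
  ℓ-at-zero (suc _) = 0

  ℓ-at-zero≤ℓ : ∀ r → ℓ-at-zero r ≤ ℓ
  ℓ-at-zero≤ℓ zero    = ℕ.≤-refl
  ℓ-at-zero≤ℓ (suc _) = z≤n

  ℓ-at-zero-pos : ∀ {r} → 0 < ℓ-at-zero r → r ≡ 0
  ℓ-at-zero-pos {zero} _ = refl

  spaced : ℕ → ℕ
  spaced x = ℓ-at-zero (x % p)

  spacedBroadcast : Fin n → ℕ
  spacedBroadcast v = spaced (toℕ v)

  spacedBroadcast-independent : IsIndepBroadcast n gens spacedBroadcast
  spacedBroadcast-independent =
    (λ v D (_ , w , ecc) → ℕ.≤-trans (ℓ-at-zero≤ℓ _) (ℓ≤ecc ecc)) ,
    (λ v e ecc → ℕ.≤-trans (ℓ-at-zero≤ℓ _) (ℓ≤ecc ecc)) ,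
    λ u v u≢v fu>0 fv>0 d ((ws , walk , ws≤d) , _) →
      ℕ.≤-trans (s≤s (ℓ-at-zero≤ℓ _)) (ℕ.≤-trans
        (p≤length-between-multiples u≢v (ℓ-at-zero-pos fu>0) (ℓ-at-zero-pos fv>0) walk) ws≤d)

  ∑-spaced : ∀ j → ∑ (j * p) spaced ≡ j * ℓ
  ∑-spaced zero    = refl
  ∑-spaced (suc j) = begin
    ∑ (p + j * p) spaced                        ≡⟨ ∑-+ p (j * p) spaced ⟩
    ∑ p spaced + ∑ (j * p) (spaced ∘ (_+_ p))   ≡⟨ cong₂ _+_ first-block (∑-cong (j * p) (λ _ → shift)) ⟩
    ℓ + ∑ (j * p) spaced                        ≡⟨ cong (_+_ ℓ) (∑-spaced j) ⟩
    ℓ + j * ℓ                                   ∎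
    where
    open ≡-Reasoning
    first-block : ∑ p spaced ≡ ℓ
    first-block = trans (cong (_+_ ℓ) (∑-zero ℓ (λ t<ℓ → cong ℓ-at-zero (m<n⇒m%n≡m (s≤s t<ℓ)))))
                        (ℕ.+-identityʳ ℓ)
    shift : ∀ {t} → spaced (p + t) ≡ spaced t
    shift {t} = cong ℓ-at-zero (%-remove-+ˡ t (∣-refl {p}))

  spacedBroadcast-cost : cost n spacedBroadcast ≡ ℓ * k
  spacedBroadcast-cost = trans (sum-tabulate n (λ _ → refl)) (trans (∑-spaced k) (ℕ.*-comm k ℓ))

  module _ {f : Fin n → ℕ} (f-independent : IsIndepBroadcast n gens f) where

    F : ℕ → ℕ
    F x = f (vertex x)

    gap-bound : ∀ x {g} → 0 < g → g ≤ n → 0 < F x → 0 < F (x + g) → p * F x ≤ ℓ * g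
    gap-bound x {g} g>0 g≤n Fx>0 Fx+g>0 with ℕ.m≤n⇒m<n∨m≡n g≤n
    ... | inj₂ refl =
      let e , ecc , e≤ℓ*k = ecc-exists (vertex x) (reach-within-ℓ*k (vertex x)) in begin
      p * F x         ≤⟨ ℕ.*-monoʳ-≤ p (ℕ.≤-trans (proj₁ (proj₂ f-independent) (vertex x) e ecc) e≤ℓ*k) ⟩
      p * (ℓ * k)     ≡⟨ ℓ*n≡p*[ℓ*k] ⟨
      ℓ * n           ∎
      where open ℕ.≤-Reasoning
    ... | inj₁ g<n =
      let d , dist , d≤hops = dist-exists (reach-forward g (vertex-+ x g)) in
      ℕ.+-cancelʳ-≤ p (p * F x) (ℓ * g) (begin
      p * F x + p       ≡⟨ ℕ.+-comm (p * F x) p ⟩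
      p + p * F x       ≡⟨ ℕ.*-suc p (F x) ⟨
      p * suc (F x)     ≤⟨ ℕ.*-monoʳ-≤ p (proj₂ (proj₂ f-independent) _ _ (vertex-+-≢ x g>0 g<n)
                                                                       Fx>0 Fx+g>0 d dist) ⟩
      p * d             ≤⟨ ℕ.*-monoʳ-≤ p d≤hops ⟩
      p * hops g        ≤⟨ p*hops[t]≤ℓ*t+p g ⟩
      ℓ * g + p         ∎)
      where open ℕ.≤-Reasoning

    -- Start the cycle at a broadcasting vertex r: its second copy, at position n, closes the
    -- last gap.
    cost≤ℓ*k : cost n f ≤ ℓ * k
    cost≤ℓ*k with any? (λ i → 0 ℕ.<? f i)
    ... | no nothing-broadcasts = ℕ.≤-trans (ℕ.≤-reflexive cost≡0) z≤n
      where
      cost≡0 : cost n f ≡ 0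
      cost≡0 = trans (sum-tabulate n (λ i → ℕ.n≤0⇒n≡0 (ℕ.≮⇒≥ (nothing-broadcasts ∘ (i ,_)))))
                     (∑-zero n (λ _ → refl))
    ... | yes (i , fi>0) = ℕ.*-cancelˡ-≤ p (begin
      p * cost n f            ≡⟨ cong (p *_) cost≡∑ ⟩
      p * ∑ n (F ∘ (_+_ r))   ≤⟨ ∑-gap-bound {c = p} {d = ℓ} _ gap n ℕ.≤-refl ℕ.≤-refl Fr+n>0 ⟩
      ℓ * n                   ≡⟨ ℓ*n≡p*[ℓ*k] ⟩
      p * (ℓ * k)             ∎)
      where
      open ℕ.≤-Reasoning
      r : ℕ
      r = toℕ i
      cost≡∑ : cost n f ≡ ∑ n (F ∘ (_+_ r))
      cost≡∑ = trans (sum-tabulate n (λ j → cong f (sym (vertex-toℕ j))))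
                     (sym (∑-periodic-shift n (cong f ∘ vertex-periodic) r))
      Fr+n>0 : 0 < F (r + n)
      Fr+n>0 = subst (λ v → 0 < f v)
        (sym (trans (cong vertex (ℕ.+-comm r n)) (trans (vertex-periodic r) (vertex-toℕ i)))) fi>0
      gap : ∀ {s t} → s < t → t ≤ n → 0 < F (r + s) → 0 < F (r + t) → p * F (r + s) ≤ ℓ * (t ∸ s)
      gap {s} {t} s<t t≤n Fs>0 Ft>0 =
        gap-bound (r + s) (ℕ.m<n⇒0<n∸m s<t) (ℕ.≤-trans (ℕ.m∸n≤m t s) t≤n) Fs>0
          (subst (λ y → 0 < F y) (trans (cong (_+_ r) (sym (ℕ.m+[n∸m]≡n (ℕ.<⇒≤ s<t))))
                                        (sym (ℕ.+-assoc r s (t ∸ s)))) Ft>0)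

  isBroadcastIndepNumber : IsBroadcastIndepNumber n gens (ℓ * k)
  isBroadcastIndepNumber =
    (spacedBroadcast , spacedBroadcast-independent , spacedBroadcast-cost) , λ _ → cost≤ℓ*k

  gens′ : List ℤ
  gens′ = + 1 ∷ ℤ.- (+ n ℤ.- + a) ∷ []

  same-reach : SameReach n gens gens′
  same-reach = reach-translate gens→gens′ , reach-translate gens′→gens
    where
    a≡a-n : + a ≡ ℤ.- (+ n ℤ.- + a) [mod + n ]
    a≡a-n = mod∣ (divides (+ 1) (identity (+ a) (+ n)))
      where
      identity : ∀ a n → a ℤ.- ℤ.- (n ℤ.- a) ≡ + 1 ℤ.* n
      identity = ℤ-Solver.solve-∀
    gens→gens′ : ∀ {b} → b ∈ gens → ∃[ c ] (c ∈ gens′ × (b ≡ c [mod + n ]))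
    gens→gens′ (here refl)         = _ , here refl , ≡[mod]-refl
    gens→gens′ (there (here refl)) = _ , there (here refl) , a≡a-n
    gens′→gens : ∀ {b} → b ∈ gens′ → ∃[ c ] (c ∈ gens × (b ≡ c [mod + n ]))
    gens′→gens (here refl)         = _ , here refl , ≡[mod]-refl
    gens′→gens (there (here refl)) = _ , there (here refl) , ≡[mod]-sym a≡a-n

open import Data.Nat using (_*_)
open import Data.Integer using (+_; -_; _-_)

theorem25 : ∀ (n a k : ℕ) → n ≡ k * (a ∸ 1) → 4 ≤ a → 3 ≤ k →
    IsBroadcastIndepNumber n (+ 1 ∷ + a ∷ []) ((a ∸ 2) * k)
    × IsBroadcastIndepNumber n (+ 1 ∷ - (+ n - + a) ∷ []) ((a ∸ 2) * k)
theorem25 _ a k refl (s≤s (s≤s (s≤s (s≤s _)))) (s≤s (s≤s (s≤s _))) =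
  isBroadcastIndepNumber , isBroadcastIndepNumber-transport same-reach isBroadcastIndepNumber
  where open Circulant-1-a (a ∸ 2) k
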